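{- Let $D_1,D_2$ be Eulerian digraphs with $|V(D_1)\cap V(D_2)|=1$, and let $D=D_1\ast D_2$. Then: (i) if $\mathcal{A}$ is a partition of $D$ into cycles, then $\mathcal{A}\cap\mathcal{B}(D_i)$ is a partition of $D_i$ into cycles for each $i=1,2$; (ii) if $\mathcal{A}$ is the unique partition of $D$ into cycles, then $\mathcal{A}\cap\mathcal{B}(D_i)$ is the unique partition of $D_i$ into cycles for each $i=1,2$; (iii) if $D_i$ has a unique partition $\mathcal{A}_i$ into cycles for $i=1,2$, then $\mathcal{A}_1\sqcup\mathcal{A}_2$ is the unique partition of $D$ into cycles.
   Context: A digraph is a triple $D=(V(D),E(D),\psi)$ with finite sets and $\psi:E(D)\to V(D)\times V(D)$ having distinct coordinates (no loops; parallel edges allowed). Walks follow edge directions; a circuit is a closed trail up to cyclic rotation; a cycle is a circuit with no repeated vertices; $\mathcal{B}(D)$ is the set of cycles of $D$. $D$ is Eulerian if it has a closed trail traversing every edge. A partition of $D$ into cycles is a set $\mathcal{A}\subseteq\mathcal{B}(D)$ whose edge sets partition $E(D)$. For digraphs $D_1,D_2$ with exactly one common vertex, $D_1\ast D_2$ is their union. -}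

module Defs where

open import Data.List using (List; []; _∷_; _++_; map)
open import Data.List.Membership.Propositional using (_∈_)
open import Data.List.Membership.Propositional.Properties using (∈-++⁺ˡ; ∈-++⁺ʳ; ∈-++⁻)
open import Data.List.Relation.Unary.All using (All)
open import Data.List.Relation.Unary.Linked using (Linked)
open import Data.List.Relation.Unary.Unique.Propositional using (Unique)
open import Data.Product using (Σ; ∃; ∃₂; _×_; _,_; proj₁; proj₂)
open import Data.Sum using (_⊎_; inj₁; inj₂)
open import Data.Unit using (⊤)
open import Data.Empty using (⊥)
open import Relation.Binary.PropositionalEquality using (_≡_; _≢_)

-- All digraphs live over an ambient vertex type V, an ambient edge type E and an
-- ambient incidence map ψ : E → V × V (tail, head).
module _ {V E : Set} (ψ : E → V × V) where

  tl : E → V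
  tl e = proj₁ (ψ e)

  hd : E → V
  hd e = proj₂ (ψ e)

  record Digraph : Set where
    field
      verts    : List V
      edges    : List E
      tl-in    : ∀ {e} → e ∈ edges → tl e ∈ verts
      hd-in    : ∀ {e} → e ∈ edges → hd e ∈ verts
      loopless : ∀ {e} → e ∈ edges → tl e ≢ hd e
  open Digraph public

  Step : E → E → Set
  Step e f = hd e ≡ tl f

  lastOf : E → List E → E
  lastOf e []       = e
  lastOf e (f ∷ fs) = lastOf f fs

  -- a closed walk given by its edge sequence (the empty sequence is the trivial
  -- closed walk at a vertex)
  IsClosedWalk : List E → Set
  IsClosedWalk []       = ⊤
  IsClosedWalk (e ∷ es) = Linked Step (e ∷ es) × Step (lastOf e es) e

  NonEmpty : List E → Set
  NonEmpty []      = ⊥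
  NonEmpty (_ ∷ _) = ⊤

  IsClosedTrail : Digraph → List E → Set
  IsClosedTrail D T = All (_∈ edges D) T × IsClosedWalk T × Unique T

  -- cycle of D (representative edge sequence): nonempty closed trail with no
  -- repeated vertex (the vertices visited are the tails of its edges)
  IsCycle : Digraph → List E → Set
  IsCycle D C = NonEmpty C × IsClosedTrail D C × Unique (map tl C)

  -- cyclic rotation: circuits/cycles are taken up to this equivalence
  _≈rot_ : List E → List E → Set
  C ≈rot C' = ∃₂ λ xs ys → C ≡ xs ++ ys × C' ≡ ys ++ xs

  Eulerian : Digraph → Set
  Eulerian D = Σ (List E) λ T → IsClosedTrail D T × (∀ e → e ∈ edges D → e ∈ T)

  -- a set of cycles, given by a predicate on representatives
  CycleSet : Set₁
  CycleSet = List E → Set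

  _≐_ : CycleSet → CycleSet → Set
  𝒜 ≐ ℬ = (∀ C → 𝒜 C → Σ (List E) λ C' → ℬ C' × C ≈rot C')
        × (∀ C → ℬ C → Σ (List E) λ C' → 𝒜 C' × C ≈rot C')

  IsPartition : Digraph → CycleSet → Set
  IsPartition D 𝒜 =
      (∀ C → 𝒜 C → IsCycle D C)
    × (∀ e → e ∈ edges D → Σ (List E) λ C → 𝒜 C × e ∈ C)
    × (∀ e C C' → 𝒜 C → 𝒜 C' → e ∈ C → e ∈ C' → C ≈rot C')

  IsUniquePartition : Digraph → CycleSet → Set₁
  IsUniquePartition D 𝒜 = IsPartition D 𝒜 × (∀ ℬ → IsPartition D ℬ → ℬ ≐ 𝒜)

  _∩B_ : CycleSet → Digraph → CycleSet
  (𝒜 ∩B D) C = 𝒜 C × IsCycle D C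

  _⊔_ : CycleSet → CycleSet → CycleSet
  (𝒜 ⊔ ℬ) C = 𝒜 C ⊎ ℬ C

  ExactlyOneCommonVertex : Digraph → Digraph → Set
  ExactlyOneCommonVertex D₁ D₂ =
    Σ V λ v → v ∈ verts D₁ × v ∈ verts D₂
            × (∀ w → w ∈ verts D₁ → w ∈ verts D₂ → w ≡ v)

  _∗_ : Digraph → Digraph → Digraph
  D₁ ∗ D₂ = record
    { verts = verts D₁ ++ verts D₂
    ; edges = edges D₁ ++ edges D₂
    ; tl-in = λ {e} p → inV (tl-in D₁) (tl-in D₂) (∈-++⁻ (edges D₁) p)
    ; hd-in = λ {e} p → inV (hd-in D₁) (hd-in D₂) (∈-++⁻ (edges D₁) p)
    ; loopless = λ {e} p → lp (∈-++⁻ (edges D₁) p)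
    }
    where
    inV : ∀ {e v} → (e ∈ edges D₁ → v ∈ verts D₁) → (e ∈ edges D₂ → v ∈ verts D₂)
        → e ∈ edges D₁ ⊎ e ∈ edges D₂ → v ∈ verts D₁ ++ verts D₂
    inV f g (inj₁ p) = ∈-++⁺ˡ (f p)
    inV f g (inj₂ p) = ∈-++⁺ʳ (verts D₁) (g p)
    lp : ∀ {e} → e ∈ edges D₁ ⊎ e ∈ edges D₂ → tl e ≢ hd e
    lp (inj₁ p) = loopless D₁ p
    lp (inj₂ p) = loopless D₂ p

{-# OPTIONS --safe #-}
-- A cycle of D₁ ∗ D₂ cannot use edges of both sides: a walk can only pass from one
-- side to the other through the common vertex v, so a closed walk using both sides
-- passes through v once on the way out and once on the way back, visiting v twice.
-- Hence the cycles of D₁ ∗ D₂ are exactly the cycles of D₁ together with those of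
-- D₂, and partitions into cycles of D₁ ∗ D₂ are exactly unions of partitions of the
-- two sides; all three parts follow from this.
module Submission where

open import Defs
open import Data.Empty using (⊥; ⊥-elim)
open import Data.List using (List; []; _∷_; map)
open import Data.List.Membership.Propositional using (_∈_)
open import Data.List.Membership.Propositional.Properties using (∈-++⁺ˡ; ∈-++⁺ʳ; ∈-++⁻)
open import Data.List.Relation.Unary.All as All using (All; []; _∷_)
open import Data.List.Relation.Unary.All.Properties using (All¬⇒¬Any; map⁻)
open import Data.List.Relation.Unary.Any using (Any; here; there)
open import Data.List.Relation.Unary.Linked using (Linked; [-]; _∷_)
open import Data.List.Relation.Unary.AllPairs using (_∷_)
open import Data.List.Relation.Unary.Unique.Propositional using (Unique)
open import Data.Product using (Σ; _×_; _,_; proj₁; proj₂)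
open import Data.Sum as Sum using (_⊎_; inj₁; inj₂)
open import Function using (_∘_)
open import Relation.Binary.PropositionalEquality using (_≡_; _≢_; refl; sym; trans; subst)

module _ {V E : Set} {ψ : E → V × V} where

  ≈rot-sym : ∀ {C C'} → _≈rot_ ψ C C' → _≈rot_ ψ C' C
  ≈rot-sym (xs , ys , p , q) = ys , xs , q , p

  ≈rot-∈ : ∀ {C C' e} → _≈rot_ ψ C C' → e ∈ C' → e ∈ C
  ≈rot-∈ (xs , ys , refl , refl) m = Sum.[ ∈-++⁺ʳ xs , ∈-++⁺ˡ ] (∈-++⁻ ys m)

  ≈rot-All : ∀ {P : E → Set} {C C'} → _≈rot_ ψ C C' → All P C → All P C'
  ≈rot-All r pC = All.tabulate (λ m → All.lookup pC (≈rot-∈ r m))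

  isCycle-edges : ∀ D {C} → IsCycle ψ D C → All (_∈ edges D) C
  isCycle-edges _ (_ , (inD , _) , _) = inD

  isCycle-within : ∀ D D' {C} → IsCycle ψ D C → All (_∈ edges D') C → IsCycle ψ D' C
  isCycle-within _ _ (ne , (_ , closed , unique) , tlUnique) inD' =
    ne , (inD' , closed , unique) , tlUnique

  OnlyCommonVertex : V → Digraph ψ → Digraph ψ → Set
  OnlyCommonVertex v A B = ∀ w → w ∈ verts A → w ∈ verts B → w ≡ v

  module Crossing (A B : Digraph ψ) (v : V) (only : OnlyCommonVertex v A B) where

    InAorB : E → Set
    InAorB x = x ∈ edges A ⊎ x ∈ edges B

    enterB-tl≡v : ∀ {x y} → Step ψ x y → x ∈ edges A → y ∈ edges B → tl ψ y ≡ v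
    enterB-tl≡v s xA yB = only _ (subst (_∈ verts A) s (hd-in A xA)) (tl-in B yB)

    enterA-tl≡v : ∀ {x y} → Step ψ x y → x ∈ edges B → y ∈ edges A → tl ψ y ≡ v
    enterA-tl≡v s xB yA = only _ (tl-in A yA) (subst (_∈ verts B) s (hd-in B xB))

    returnToA-via-v : ∀ {p xs e} → p ∈ edges B → e ∈ edges A
      → Linked (Step ψ) (p ∷ xs) → Step ψ (lastOf ψ p xs) e → All InAorB xs
      → tl ψ e ≡ v ⊎ Any (λ x → tl ψ x ≡ v) xs
    returnToA-via-v pB eA [-] s [] = inj₁ (enterA-tl≡v s pB eA)
    returnToA-via-v pB eA (s ∷ _) _ (inj₁ xA ∷ _) = inj₂ (here (enterA-tl≡v s pB xA))
    returnToA-via-v pB eA (_ ∷ lk) closing (inj₂ xB ∷ sides) =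
      Sum.map₂ there (returnToA-via-v xB eA lk closing sides)

    -- Leaving A would enter B through v, and by
    -- returnToA-via-v the way back to e passes v again; the tails of xs and e being
    -- pairwise distinct, this cannot happen.
    closedWalk-stays-in-A : ∀ {p xs e} → p ∈ edges A → e ∈ edges A
      → Linked (Step ψ) (p ∷ xs) → Step ψ (lastOf ψ p xs) e → All InAorB xs
      → All (tl ψ e ≢_) (map (tl ψ) xs) → Unique (map (tl ψ) xs)
      → All (_∈ edges A) xs
    closedWalk-stays-in-A _ _ [-] _ [] _ _ = []
    closedWalk-stays-in-A _ eA (_ ∷ lk) closing (inj₁ xA ∷ sides) (_ ∷ e≢) (_ ∷ unique) =
      xA ∷ closedWalk-stays-in-A xA eA lk closing sides e≢ unique
    closedWalk-stays-in-A {xs = x ∷ xs} {e} pA eA (s ∷ lk) closing (inj₂ xB ∷ sides)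
                          (e≢x ∷ _) (x≢ ∷ _) =
      ⊥-elim (v-visited-twice (enterB-tl≡v s pA xB) (returnToA-via-v xB eA lk closing sides))
      where
      v-visited-twice : tl ψ x ≡ v → tl ψ e ≡ v ⊎ Any (λ y → tl ψ y ≡ v) xs → ⊥
      v-visited-twice tlx≡v (inj₁ tle≡v) = e≢x (trans tle≡v (sym tlx≡v))
      v-visited-twice tlx≡v (inj₂ later) =
        All¬⇒¬Any (All.map (λ x≢y → x≢y ∘ trans tlx≡v ∘ sym) (map⁻ x≢)) later

  ∗-cycle-in-one-side : ∀ {D₁ D₂ v C} → OnlyCommonVertex v D₁ D₂
    → IsCycle ψ (_∗_ ψ D₁ D₂) C → All (_∈ edges D₁) C ⊎ All (_∈ edges D₂) C
  ∗-cycle-in-one-side {C = []} _ (() , _)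
  ∗-cycle-in-one-side {D₁} {D₂} {C = _ ∷ _} only (_ , (inD , (lk , closing) , _) , e≢ ∷ unique)
    with All.map (∈-++⁻ (edges D₁)) inD
  ... | inj₁ eD₁ ∷ sides =
    inj₁ (eD₁ ∷ Crossing.closedWalk-stays-in-A D₁ D₂ _ only
                  eD₁ eD₁ lk closing sides e≢ unique)
  ... | inj₂ eD₂ ∷ sides =
    inj₂ (eD₂ ∷ Crossing.closedWalk-stays-in-A D₂ D₁ _ (λ w w₂ w₁ → only w w₁ w₂)
                  eD₂ eD₂ lk closing (All.map Sum.swap sides) e≢ unique)

  record CycleSeparation (D A B : Digraph ψ) : Set where
    field
      edgeˡ : ∀ {e} → e ∈ edges A → e ∈ edges D
      edgeʳ : ∀ {e} → e ∈ edges B → e ∈ edges D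
      edge-split : ∀ {e} → e ∈ edges D → e ∈ edges A ⊎ e ∈ edges B
      edge-disjoint : ∀ {e} → e ∈ edges A → e ∈ edges B → ⊥
      cycle-in-one-side : ∀ {C} → IsCycle ψ D C
        → All (_∈ edges A) C ⊎ All (_∈ edges B) C

  ∗-cycleSeparation : ∀ {D₁ D₂ v} → OnlyCommonVertex v D₁ D₂
    → CycleSeparation (_∗_ ψ D₁ D₂) D₁ D₂
  ∗-cycleSeparation {D₁} {D₂} only = record
    { edgeˡ = ∈-++⁺ˡ
    ; edgeʳ = ∈-++⁺ʳ (edges D₁)
    ; edge-split = ∈-++⁻ (edges D₁)
    ; edge-disjoint = λ e₁ e₂ → loopless D₁ e₁
        (trans (only _ (tl-in D₁ e₁) (tl-in D₂ e₂))
               (sym (only _ (hd-in D₁ e₁) (hd-in D₂ e₂))))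
    ; cycle-in-one-side = ∗-cycle-in-one-side {D₁} {D₂} only
    }

  CycleSeparation-swap : ∀ {D A B} → CycleSeparation D A B → CycleSeparation D B A
  CycleSeparation-swap S = record
    { edgeˡ = edgeʳ
    ; edgeʳ = edgeˡ
    ; edge-split = Sum.swap ∘ edge-split
    ; edge-disjoint = λ eB eA → edge-disjoint eA eB
    ; cycle-in-one-side = Sum.swap ∘ cycle-in-one-side
    }
    where open CycleSeparation S

  module _ {D A B : Digraph ψ} (S : CycleSeparation D A B) where
    open CycleSeparation S

    cycles-edge-disjoint : ∀ {C C' e} → IsCycle ψ A C → IsCycle ψ B C'
      → e ∈ C → e ∈ C' → ⊥
    cycles-edge-disjoint cyA cyB m m' =
      edge-disjoint (All.lookup (isCycle-edges A cyA) m) (All.lookup (isCycle-edges B cyB) m')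

    cycle-through-A : ∀ {C e} → IsCycle ψ D C → e ∈ C → e ∈ edges A → All (_∈ edges A) C
    cycle-through-A cy m eA with cycle-in-one-side cy
    ... | inj₁ inA = inA
    ... | inj₂ inB = ⊥-elim (edge-disjoint eA (All.lookup inB m))

    partition-∩B : ∀ {𝒜} → IsPartition ψ D 𝒜 → IsPartition ψ A (_∩B_ ψ 𝒜 A)
    partition-∩B {𝒜} (cycles , cover , unique) =
      (λ _ → proj₂) , coverA , λ e C C' x x' → unique e C C' (proj₁ x) (proj₁ x')
      where
      coverA : ∀ e → e ∈ edges A → Σ (List E) λ C → _∩B_ ψ 𝒜 A C × e ∈ C
      coverA e eA with cover e (edgeˡ eA)
      ... | C , aC , m =
        C , (aC , isCycle-within D A (cycles C aC) (cycle-through-A (cycles C aC) m eA)) , m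

    partition-⊔ : ∀ {𝒳 𝒴} → IsPartition ψ A 𝒳 → IsPartition ψ B 𝒴
      → IsPartition ψ D (_⊔_ ψ 𝒳 𝒴)
    partition-⊔ {𝒳} {𝒴} (cyclesX , coverX , uniqueX) (cyclesY , coverY , uniqueY) =
      cycles , (λ e → cover e ∘ edge-split) , unique
      where
      cycles : ∀ C → _⊔_ ψ 𝒳 𝒴 C → IsCycle ψ D C
      cycles C (inj₁ x) = let cy = cyclesX C x in
        isCycle-within A D cy (All.map edgeˡ (isCycle-edges A cy))
      cycles C (inj₂ y) = let cy = cyclesY C y in
        isCycle-within B D cy (All.map edgeʳ (isCycle-edges B cy))
      cover : ∀ e → e ∈ edges A ⊎ e ∈ edges B
        → Σ (List E) λ C → _⊔_ ψ 𝒳 𝒴 C × e ∈ C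
      cover e (inj₁ eA) = let C , x , m = coverX e eA in C , inj₁ x , m
      cover e (inj₂ eB) = let C , y , m = coverY e eB in C , inj₂ y , m
      unique : ∀ e C C' → _⊔_ ψ 𝒳 𝒴 C → _⊔_ ψ 𝒳 𝒴 C'
        → e ∈ C → e ∈ C' → _≈rot_ ψ C C'
      unique e C C' (inj₁ x) (inj₁ x') m m' = uniqueX e C C' x x' m m'
      unique e C C' (inj₂ y) (inj₂ y') m m' = uniqueY e C C' y y' m m'
      unique e C C' (inj₁ x) (inj₂ y') m m' =
        ⊥-elim (cycles-edge-disjoint (cyclesX C x) (cyclesY C' y') m m')
      unique e C C' (inj₂ y) (inj₁ x') m m' =
        ⊥-elim (cycles-edge-disjoint (cyclesX C' x') (cyclesY C y) m' m)

  module _ {D A B : Digraph ψ} (S : CycleSeparation D A B) where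
    open CycleSeparation S

    uniquePartition-∩B : ∀ {𝒜} → IsUniquePartition ψ D 𝒜
      → IsUniquePartition ψ A (_∩B_ ψ 𝒜 A)
    uniquePartition-∩B {𝒜} (P , unique) = partition-∩B S P , λ ℬ Pℬ →
      restrict ℬ Pℬ (unique _ (partition-⊔ S Pℬ (partition-∩B (CycleSeparation-swap S) P)))
      where
      restrict : ∀ ℬ → IsPartition ψ A ℬ
        → _≐_ ψ (_⊔_ ψ ℬ (_∩B_ ψ 𝒜 B)) 𝒜 → _≐_ ψ ℬ (_∩B_ ψ 𝒜 A)
      restrict ℬ Pℬ (to𝒜 , from𝒜) = to , from
        where
        to : ∀ C → ℬ C → Σ (List E) λ C' → _∩B_ ψ 𝒜 A C' × _≈rot_ ψ C C'
        to C b with to𝒜 C (inj₁ b)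
        ... | C' , a , r =
          C' , (a , isCycle-within D A (proj₁ P C' a)
                      (≈rot-All r (isCycle-edges A (proj₁ Pℬ C b)))) , r
        from : ∀ C → _∩B_ ψ 𝒜 A C → Σ (List E) λ C' → ℬ C' × _≈rot_ ψ C C'
        from C (a , cyA) with from𝒜 C a
        ... | C' , inj₁ b , r = C' , b , r
        from (e ∷ _) (a , cyA) | C' , inj₂ (_ , cyB) , r =
          ⊥-elim (cycles-edge-disjoint S cyA cyB (here refl) (≈rot-∈ (≈rot-sym r) (here refl)))

    uniquePartition-⊔ : ∀ {𝒳 𝒴} → IsUniquePartition ψ A 𝒳 → IsUniquePartition ψ B 𝒴
      → IsUniquePartition ψ D (_⊔_ ψ 𝒳 𝒴)
    uniquePartition-⊔ {𝒳} {𝒴} (PX , uniqueX) (PY , uniqueY) =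
      partition-⊔ S PX PY , λ ℬ Pℬ → split ℬ Pℬ
        (uniqueX _ (partition-∩B S Pℬ))
        (uniqueY _ (partition-∩B (CycleSeparation-swap S) Pℬ))
      where
      split : ∀ ℬ → IsPartition ψ D ℬ → _≐_ ψ (_∩B_ ψ ℬ A) 𝒳 → _≐_ ψ (_∩B_ ψ ℬ B) 𝒴
        → _≐_ ψ ℬ (_⊔_ ψ 𝒳 𝒴)
      split ℬ (cycles , _) (toX , fromX) (toY , fromY) = to , from
        where
        to : ∀ C → ℬ C → Σ (List E) λ C' → _⊔_ ψ 𝒳 𝒴 C' × _≈rot_ ψ C C'
        to C b with cycle-in-one-side (cycles C b)
        ... | inj₁ inA = let C' , x , r = toX C (b , isCycle-within D A (cycles C b) inA)
                         in C' , inj₁ x , r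
        ... | inj₂ inB = let C' , y , r = toY C (b , isCycle-within D B (cycles C b) inB)
                         in C' , inj₂ y , r
        from : ∀ C → _⊔_ ψ 𝒳 𝒴 C → Σ (List E) λ C' → ℬ C' × _≈rot_ ψ C C'
        from C (inj₁ x) = let C' , (b , _) , r = fromX C x in C' , b , r
        from C (inj₂ y) = let C' , (b , _) , r = fromY C y in C' , b , r

mainTheorem5 : {V E : Set} (ψ : E → V × V) (D₁ D₂ : Digraph ψ)
    → Eulerian ψ D₁ → Eulerian ψ D₂ → ExactlyOneCommonVertex ψ D₁ D₂
    -- (i)
    → ((𝒜 : CycleSet ψ) → IsPartition ψ (_∗_ ψ D₁ D₂) 𝒜
         → IsPartition ψ D₁ (_∩B_ ψ 𝒜 D₁) × IsPartition ψ D₂ (_∩B_ ψ 𝒜 D₂))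
    -- (ii)
    × ((𝒜 : CycleSet ψ) → IsUniquePartition ψ (_∗_ ψ D₁ D₂) 𝒜
         → IsUniquePartition ψ D₁ (_∩B_ ψ 𝒜 D₁) × IsUniquePartition ψ D₂ (_∩B_ ψ 𝒜 D₂))
    -- (iii)
    × ((𝒜₁ 𝒜₂ : CycleSet ψ) → IsUniquePartition ψ D₁ 𝒜₁ → IsUniquePartition ψ D₂ 𝒜₂
         → IsUniquePartition ψ (_∗_ ψ D₁ D₂) (_⊔_ ψ 𝒜₁ 𝒜₂))
mainTheorem5 ψ D₁ D₂ _ _ (_ , _ , _ , only) =
    (λ _ P → partition-∩B S₁ P , partition-∩B S₂ P)
  , (λ _ U → uniquePartition-∩B S₁ U , uniquePartition-∩B S₂ U)
  , (λ _ _ → uniquePartition-⊔ S₁)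
  where
  S₁ : CycleSeparation (_∗_ ψ D₁ D₂) D₁ D₂
  S₁ = ∗-cycleSeparation only
  S₂ : CycleSeparation (_∗_ ψ D₁ D₂) D₂ D₁
  S₂ = CycleSeparation-swap S₁
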